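{- A Boolean combination $\varphi$ of core formulae is valid if and only if $\vdash_{\mathsf{C}}\varphi$.
   Context: Let $\mathrm{PVAR}$ be a countably infinite set of program variables and $\mathrm{LOC}$ a countably infinite set of locations. A memory state is a pair $(s,h)$ with $s:\mathrm{PVAR}\to\mathrm{LOC}$ and $h:\mathrm{LOC}\to\mathrm{LOC}$ a partial function with finite domain $\mathrm{dom}(h)$. Formulae of separation logic $\mathrm{SL}(*,-\!*)$: $\varphi ::= x=y \mid x\hookrightarrow y \mid \mathrm{emp} \mid \neg\varphi \mid \varphi\wedge\varphi \mid \varphi*\varphi \mid \varphi -\!* \varphi$, with the standard heaplet semantics ($x\hookrightarrow y$: $s(x)\in\mathrm{dom}(h)$ and $h(s(x))=s(y)$; $\mathrm{emp}$: empty heap; $*$: split of the heap into two disjoint heaps satisfying the two sides; $\varphi-\!*\psi$: every disjoint extension satisfying $\varphi$ gives a heap satisfying $\psi$). Valid means satisfied by all memory states. Abbreviations: $\bot:=\neg(x=x)$, $\top:=\neg\bot$, $x\neq y:=\neg(x=y)$, $\mathrm{alloc}(x):=(x\hookrightarrow x)-\!*\bot$ (holds iff $s(x)\in\mathrm{dom}(h)$), $\mathrm{size}\geq0:=\top$, $\mathrm{size}\geq1:=\neg\mathrm{emp}$, $\mathrm{size}\geq\beta+2:=\neg\mathrm{emp}*\mathrm{size}\geq\beta+1$ (holds iff $|\mathrm{dom}(h)|\geq\beta$). Core formulae are the formulae $x=y$, $\mathrm{alloc}(x)$, $x\hookrightarrow y$, $\mathrm{size}\geq\beta$ ($x,y\in\mathrm{PVAR}$,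 $\beta\in\mathbb{N}$). The Hilbert-style system $\mathsf{C}$ consists of all instances of propositional tautologies, modus ponens, and the axiom schemata (with $\varphi$ ranging over formulae, $x,y,z$ over program variables, $\beta$ over naturals, $X$ over finite sets of variables, and $\varphi[y\leftarrow x]$ the replacement of every occurrence of $y$ by $x$): $x=x$; $\varphi\wedge x=y\Rightarrow\varphi[y\leftarrow x]$; $x\hookrightarrow y\Rightarrow\mathrm{alloc}(x)$; $x\hookrightarrow y\wedge x\hookrightarrow z\Rightarrow y=z$; $\mathrm{size}\geq\beta+1\Rightarrow\mathrm{size}\geq\beta$; $\bigwedge_{x\in X}(\mathrm{alloc}(x)\wedge\bigwedge_{y\in X\setminus\{x\}}x\neq y)\Rightarrow\mathrm{size}\geq|X|$. $\vdash_{\mathsf{C}}\varphi$ means $\varphi$ is derivable. -}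

module Defs where

open import Data.Nat using (ℕ; zero; suc; _≤_; _≡ᵇ_)
open import Data.Bool using (Bool; true; false; not; _∧_; if_then_else_)
open import Data.Maybe using (Maybe; just; nothing)
open import Data.List using (List; []; _∷_; length)
open import Data.List.Relation.Unary.Unique.Propositional using (Unique)
open import Data.Product using (Σ; ∃; _×_; _,_)
open import Data.Sum using (_⊎_)
open import Data.Empty using (⊥)
open import Relation.Nullary using (¬_)
open import Relation.Binary.PropositionalEquality using (_≡_)

PVar : Set
PVar = ℕ

Loc : Set
Loc = ℕ

Store : Set
Store = PVar → Loc

record Heap : Set where
  field
    fun    : Loc → Maybe Loc
    bound  : ℕ
    finite : ∀ l → bound ≤ l → fun l ≡ nothing
open Heap public

Union : Heap → Heap → Heap → Set
Union h₁ h₂ h = ∀ l → (fun h l ≡ fun h₁ l × fun h₂ l ≡ nothing)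
                    ⊎ (fun h l ≡ fun h₂ l × fun h₁ l ≡ nothing)

data Form : Set where
  _≐_  : PVar → PVar → Form
  _↪_  : PVar → PVar → Form
  emp  : Form
  ¬'_  : Form → Form
  _∧'_ : Form → Form → Form
  _*'_ : Form → Form → Form
  _-*_ : Form → Form → Form

infix 8 _≐_ _↪_
infixr 6 _∧'_
infix 7 ¬'_

_,_⊨_ : Store → Heap → Form → Set
s , h ⊨ (x ≐ y)  = s x ≡ s y
s , h ⊨ (x ↪ y)  = fun h (s x) ≡ just (s y)
s , h ⊨ emp      = ∀ l → fun h l ≡ nothing
s , h ⊨ (¬' φ)   = ¬ (s , h ⊨ φ)
s , h ⊨ (φ ∧' ψ) = (s , h ⊨ φ) × (s , h ⊨ ψ)
s , h ⊨ (φ *' ψ) = Σ Heap λ h₁ → Σ Heap λ h₂ →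
                     Union h₁ h₂ h × (s , h₁ ⊨ φ) × (s , h₂ ⊨ ψ)
s , h ⊨ (φ -* ψ) = ∀ (h' h'' : Heap) → Union h h' h'' →
                     s , h' ⊨ φ → s , h'' ⊨ ψ

Valid : Form → Set
Valid φ = ∀ (s : Store) (h : Heap) → s , h ⊨ φ

x₀ : PVar
x₀ = 0

⊥' : Form
⊥' = ¬' (x₀ ≐ x₀)

⊤' : Form
⊤' = ¬' ⊥'

_≠'_ : PVar → PVar → Form
x ≠' y = ¬' (x ≐ y)

_⇒'_ : Form → Form → Form
φ ⇒' ψ = ¬' (φ ∧' ¬' ψ)
infixr 4 _⇒'_

alloc : PVar → Form
alloc x = (x ↪ x) -* ⊥'

size≥ : ℕ → Form
size≥ zero          = ⊤'
size≥ (suc zero)    = ¬' emp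
size≥ (suc (suc β)) = (¬' emp) *' size≥ (suc β)

⋀ : List Form → Form
⋀ []       = ⊤'
⋀ (φ ∷ φs) = φ ∧' ⋀ φs

mapL : {A B : Set} → (A → B) → List A → List B
mapL f []       = []
mapL f (a ∷ as) = f a ∷ mapL f as

remove : PVar → List PVar → List PVar
remove x []       = []
remove x (y ∷ ys) = if y ≡ᵇ x then remove x ys else y ∷ remove x ys

rn : PVar → PVar → PVar → PVar
rn y x z = if z ≡ᵇ y then x else z

_[_←_] : Form → PVar → PVar → Form
(a ≐ b)  [ y ← x ] = rn y x a ≐ rn y x b
(a ↪ b)  [ y ← x ] = rn y x a ↪ rn y x b
emp      [ y ← x ] = emp
(¬' φ)   [ y ← x ] = ¬' (φ [ y ← x ])
(φ ∧' ψ) [ y ← x ] = (φ [ y ← x ]) ∧' (ψ [ y ← x ])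
(φ *' ψ) [ y ← x ] = (φ [ y ← x ]) *' (ψ [ y ← x ])
(φ -* ψ) [ y ← x ] = (φ [ y ← x ]) -* (ψ [ y ← x ])

data PForm : Set where
  atom : ℕ → PForm
  pneg : PForm → PForm
  pand : PForm → PForm → PForm

peval : (ℕ → Bool) → PForm → Bool
peval v (atom n)   = v n
peval v (pneg p)   = not (peval v p)
peval v (pand p q) = peval v p ∧ peval v q

Tautology : PForm → Set
Tautology p = ∀ (v : ℕ → Bool) → peval v p ≡ true

instantiate : (ℕ → Form) → PForm → Form
instantiate σ (atom n)   = σ n
instantiate σ (pneg p)   = ¬' instantiate σ p
instantiate σ (pand p q) = instantiate σ p ∧' instantiate σ q

data ⊢C_ : Form → Set where
  taut   : ∀ (p : PForm) (σ : ℕ → Form) → Tautology p → ⊢C instantiate σ p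
  mp     : ∀ {φ ψ} → ⊢C φ → ⊢C (φ ⇒' ψ) → ⊢C ψ
  ax-refl : ∀ x → ⊢C (x ≐ x)
  ax-subst : ∀ φ x y → ⊢C ((φ ∧' (x ≐ y)) ⇒' (φ [ y ← x ]))
  ax-alloc : ∀ x y → ⊢C ((x ↪ y) ⇒' alloc x)
  ax-fun   : ∀ x y z → ⊢C (((x ↪ y) ∧' (x ↪ z)) ⇒' (y ≐ z))
  ax-size  : ∀ β → ⊢C (size≥ (suc β) ⇒' size≥ β)
  ax-count : ∀ (X : List PVar) → Unique X →
             ⊢C (⋀ (mapL (λ x → alloc x ∧' ⋀ (mapL (λ y → x ≠' y) (remove x X))) X)
                 ⇒' size≥ (length X))

infix 2 ⊢C_

data Core : Form → Set where
  core-eq    : ∀ x y → Core (x ≐ y)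
  core-alloc : ∀ x → Core (alloc x)
  core-pt    : ∀ x y → Core (x ↪ y)
  core-size  : ∀ β → Core (size≥ β)

data BoolComb : Form → Set where
  bc-core : ∀ {φ} → Core φ → BoolComb φ
  bc-neg  : ∀ {φ} → BoolComb φ → BoolComb (¬' φ)
  bc-and  : ∀ {φ ψ} → BoolComb φ → BoolComb ψ → BoolComb (φ ∧' ψ)

module Submission where

open import Defs
open import Function using (_∘_; id; const)
open import Function.Bundles using (_⇔_; mk⇔; Equivalence)
open import Data.Nat
  using (ℕ; zero; suc; _+_; _∸_; _⊔_; _≤_; _<_; z≤n; s≤s; z<s; _≟_; _≤?_; _<?_; _≡ᵇ_)
open import Data.Nat.Properties
open import Data.Bool using (Bool; true; false; not; _∧_; if_then_else_; T)
open import Data.Bool.Properties using (T-≡) renaming (_≟_ to _≟ᵇ_)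
open import Data.Maybe using (Maybe; just; nothing; is-just; fromMaybe; maybe′)
open import Data.Maybe.Properties using (just-injective; ≡-dec)
open import Data.Product using (Σ; ∃; ∃-syntax; _×_; _,_; proj₁; proj₂)
open import Data.List using (List; []; _∷_; _++_; length; map; downFrom)
open import Data.List.Membership.Propositional.Properties
  using (∈-++⁺ˡ; ∈-++⁺ʳ; ∈-map⁺; ∈-downFrom⁺)
open import Data.List.Relation.Unary.All using (All; []; _∷_)
import Data.List.Relation.Unary.All as All
open import Data.List.Relation.Unary.All.Properties using (++⁻ˡ; ++⁻ʳ; ++⁺; map⁺)
open import Data.List.Relation.Unary.Any using (here; there)
open import Data.List.Membership.Propositional using (_∈_)
open import Data.List.Relation.Unary.Unique.Propositional using (Unique)
open import Data.List.Relation.Unary.AllPairs using ([]; _∷_)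
open import Data.Sum using (_⊎_; inj₁; inj₂)
open import Data.Unit using (tt)
open import Relation.Nullary using (¬_; Dec; yes; no; does)
open import Relation.Nullary.Negation using (contradiction; ¬¬-map)
open import Relation.Nullary.Decidable using (¬¬-excluded-middle; map′; ¬?; _×-dec_; decidable-stable)
open import Relation.Binary.PropositionalEquality
  using (_≡_; _≢_; ≢-sym; refl; sym; trans; cong; cong₂; subst; module ≡-Reasoning)
open import Algebra.Properties.CommutativeSemigroup +-commutativeSemigroup using (x∙yz≈y∙xz)

open Equivalence using (to; from)
import Function.Properties.Equivalence as ⇔

-- Soundness.  Every axiom of C holds in every memory state and modus ponens
-- preserves truth, but tautologies are only true up to double negation
-- (Glivenko), as truth in SL is not decidable in general.  For a Boolean
-- combination of core formulae it is decidable, which removes the double negation.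
--
-- Completeness.  Read φ as a propositional formula q over core atoms, with its
-- variables below B and its sizes at most N.  A finite conjunction G of axiom
-- instances over these variables and sizes is derivable, and G ⇒ q is a
-- tautology: a valuation ν of the atoms satisfying G has the properties recorded
-- in Respects, from which module Model builds a memory state realising ν on all
-- atoms in scope; since φ is valid, q is true under ν.  Modus ponens gives ⊢C φ.

bit : Bool → ℕ
bit true  = 1
bit false = 0

count : (ℕ → Bool) → ℕ → ℕ
count p zero    = zero
count p (suc n) = bit (p n) + count p n

count-ext : ∀ {p q} n → (∀ {l} → l < n → p l ≡ q l) → count p n ≡ count q n
count-ext zero    p≗q = refl
count-ext (suc n) p≗q =
  cong₂ _+_ (cong bit (p≗q ≤-refl)) (count-ext n (p≗q ∘ m<n⇒m<1+n))

count-beyond : ∀ {p m} n → (∀ {l} → m ≤ l → p l ≡ false) → m ≤ n → count p n ≡ count p m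
count-beyond {p} {m} zero    _    z≤n = refl
count-beyond {p} {m} (suc n) none m≤ with m≤n⇒m<n∨m≡n m≤
... | inj₂ refl = refl
... | inj₁ m<1+n rewrite none (≤-pred m<1+n) = count-beyond n none (≤-pred m<1+n)

count-witness : ∀ {p} n → 0 < count p n → ∃[ l ] l < n × p l ≡ true
count-witness {p} (suc n) pos with p n in pn
... | true  = n , ≤-refl , pn
... | false with count-witness n pos
...   | l , l<n , pl = l , m<n⇒m<1+n l<n , pl

count-zero : ∀ {p} n → count p n ≡ 0 → ∀ {l} → l < n → p l ≡ false
count-zero {p} (suc n) c≡0 {l} l<1+n with p n in pn | m<1+n⇒m<n∨m≡n l<1+n
count-zero {p} (suc n) ()  l<1+n | true  | _
... | false | inj₂ refl = pn
... | false | inj₁ l<n  = count-zero n c≡0 l<n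

count-drop : ∀ {p q l} n → (∀ {m} → m ≢ l → p m ≡ q m) → p l ≡ true → q l ≡ false → l < n →
             count p n ≡ suc (count q n)
count-drop {p} {q} {l} (suc n) same pl ql l<1+n with m<1+n⇒m<n∨m≡n l<1+n
... | inj₂ refl rewrite pl | ql = cong suc (count-ext n (λ m<n → same (<⇒≢ m<n)))
... | inj₁ l<n rewrite same {n} (≢-sym (<⇒≢ l<n)) =
  trans (cong (bit (q n) +_) (count-drop n same pl ql l<n)) (+-suc (bit (q n)) (count q n))

count-split : ∀ {r p q} n → (∀ l → (r l ≡ p l × q l ≡ false) ⊎ (r l ≡ q l × p l ≡ false)) →
              count r n ≡ count p n + count q n
count-split zero    _ = refl
count-split {r} {p} {q} (suc n) split with split n
... | inj₁ (rp , qf) rewrite rp | qf =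
  trans (cong (bit (p n) +_) (count-split n split)) (sym (+-assoc (bit (p n)) (count p n) (count q n)))
... | inj₂ (rq , pf) rewrite rq | pf = begin
    bit (q n) + count r n              ≡⟨ cong (bit (q n) +_) (count-split n split) ⟩
    bit (q n) + (count p n + count q n) ≡⟨ x∙yz≈y∙xz (bit (q n)) (count p n) (count q n) ⟩
    count p n + (bit (q n) + count q n) ∎
  where
  open ≡-Reasoning

count-pad : ∀ {p} d n → (∀ {i} → i < d → p (i + n) ≡ true) → count p (d + n) ≡ d + count p n
count-pad zero    n _    = refl
count-pad (suc d) n true-on rewrite true-on {d} ≤-refl =
  cong suc (count-pad d n (true-on ∘ m<n⇒m<1+n))

count-false : ∀ n → count (const false) n ≡ 0
count-false zero    = refl
count-false (suc n) = count-false n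

count-≤ : ∀ p n → count p n ≤ n
count-≤ p zero    = z≤n
count-≤ p (suc n) with p n
... | true  = s≤s (count-≤ p n)
... | false = m≤n⇒m≤1+n (count-≤ p n)

dom : Heap → Loc → Bool
dom h l = is-just (fun h l)

size : Heap → ℕ
size h = count (dom h) (bound h)

size-from : ∀ h {n} → bound h ≤ n → size h ≡ count (dom h) n
size-from h b≤n = sym (count-beyond _ (λ b≤l → cong is-just (finite h _ b≤l)) b≤n)

cell-of-dom : ∀ h {l} → dom h l ≡ true → ∃[ v ] fun h l ≡ just v
cell-of-dom h {l} dl with fun h l
... | just v = v , refl

size-zero-emp : ∀ h → size h ≡ 0 → ∀ l → fun h l ≡ nothing
size-zero-emp h s≡0 l with bound h ≤? l
... | yes b≤l = finite h l b≤l
... | no  b≰l with fun h l | count-zero (bound h) s≡0 (≰⇒> b≰l)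
...   | nothing | _ = refl

allocated-cell : ∀ h → 0 < size h → ∃[ l ] ∃[ v ] fun h l ≡ just v
allocated-cell h pos with count-witness (bound h) pos
... | l , _ , dl = l , cell-of-dom h dl

empty : Heap
empty = record { fun = λ _ → nothing ; bound = 0 ; finite = λ _ _ → refl }

update : Heap → Loc → Maybe Loc → Heap
update h l mv = record { fun = new ; bound = bound h + suc l ; finite = new-finite }
  where
  new : Loc → Maybe Loc
  new l' with l' ≟ l
  ... | yes _ = mv
  ... | no  _ = fun h l'
  new-finite : ∀ l' → bound h + suc l ≤ l' → new l' ≡ nothing
  new-finite l' le with l' ≟ l
  ... | yes refl = contradiction (m+n≤o⇒n≤o (bound h) le) (<-irrefl refl)
  ... | no  _    = finite h l' (m+n≤o⇒m≤o (bound h) le)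

update-here : ∀ h l mv → fun (update h l mv) l ≡ mv
update-here h l mv with l ≟ l
... | yes _   = refl
... | no  l≢l = contradiction refl l≢l

update-elsewhere : ∀ h {l} mv {l'} → l' ≢ l → fun (update h l mv) l' ≡ fun h l'
update-elsewhere h {l} mv {l'} l'≢l with l' ≟ l
... | yes l'≡l = contradiction l'≡l l'≢l
... | no  _    = refl

single : Loc → Loc → Heap
single l v = update empty l (just v)

union-extend : ∀ h {l} v → fun h l ≡ nothing → Union h (single l v) (update h l (just v))
union-extend h {l} v free l' with l' ≟ l
... | yes refl = inj₂ (refl , free)
... | no  _    = inj₁ (refl , refl)

union-split : ∀ h {l v} → fun h l ≡ just v → Union (single l v) (update h l nothing) h
union-split h {l} {v} hl l' with l' ≟ l
... | yes refl = inj₁ (hl , refl)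
... | no  _    = inj₂ (refl , refl)

size-erase : ∀ h {l v} → fun h l ≡ just v → size h ≡ suc (size (update h l nothing))
size-erase h {l} hl = begin
  size h                      ≡⟨ size-from h (m≤m+n (bound h) (suc l)) ⟩
  count (dom h) n             ≡⟨ count-drop n unchanged (cong is-just hl)
                                   (cong is-just (update-here h l nothing)) (m+n≤o⇒n≤o (bound h) ≤-refl) ⟩
  suc (size (update h l nothing)) ∎
  where
  open ≡-Reasoning
  n : ℕ
  n = bound h + suc l
  unchanged : ∀ {m} → m ≢ l → dom h m ≡ dom (update h l nothing) m
  unchanged m≢l = sym (cong is-just (update-elsewhere h nothing m≢l))

size-union : ∀ h₁ h₂ h → Union h₁ h₂ h → size h ≡ size h₁ + size h₂
size-union h₁ h₂ h u = begin
  size h                                    ≡⟨ size-from h b≤n ⟩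
  count (dom h) n                           ≡⟨ count-split n dom-split ⟩
  count (dom h₁) n + count (dom h₂) n       ≡⟨ cong₂ _+_ (size-from h₁ b₁≤n) (size-from h₂ b₂≤n) ⟨
  size h₁ + size h₂                         ∎
  where
  open ≡-Reasoning
  n : ℕ
  n = bound h + bound h₁ + bound h₂
  b≤n : bound h ≤ n
  b≤n = ≤-trans (m≤m+n (bound h) (bound h₁)) (m≤m+n _ (bound h₂))
  b₁≤n : bound h₁ ≤ n
  b₁≤n = ≤-trans (m≤n+m (bound h₁) (bound h)) (m≤m+n _ (bound h₂))
  b₂≤n : bound h₂ ≤ n
  b₂≤n = m≤n+m (bound h₂) _
  dom-split : ∀ l → (dom h l ≡ dom h₁ l × dom h₂ l ≡ false) ⊎
                    (dom h l ≡ dom h₂ l × dom h₁ l ≡ false)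
  dom-split l with u l
  ... | inj₁ (e₁ , e₂) = inj₁ (cong is-just e₁ , cong is-just e₂)
  ... | inj₂ (e₁ , e₂) = inj₂ (cong is-just e₁ , cong is-just e₂)

⊤-true : ∀ s h → s , h ⊨ ⊤'
⊤-true s h x₀≢x₀ = x₀≢x₀ refl

-- alloc x holds exactly when s x is allocated: the heap cannot be
-- extended by a cell at s x.
alloc-sem : ∀ x s h → (s , h ⊨ alloc x) ⇔ (dom h (s x) ≡ true)
alloc-sem x s h = mk⇔ allocated not-free
  where
  allocated : s , h ⊨ alloc x → dom h (s x) ≡ true
  allocated a with fun h (s x) in hx
  ... | just _  = refl
  ... | nothing = contradiction refl (a (single (s x) (s x)) (update h (s x) (just (s x)))
                                        (union-extend h (s x) hx) (update-here empty (s x) _))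
  not-free : dom h (s x) ≡ true → s , h ⊨ alloc x
  not-free d h' h'' u pt with u (s x) | cell-of-dom h d
  ... | inj₁ (_ , h'-free) | _       = contradiction (trans (sym pt) h'-free) λ ()
  ... | inj₂ (_ , h-free)  | v , hx = contradiction (trans (sym hx) h-free) λ ()

size-sem : ∀ β s h → (s , h ⊨ size≥ β) ⇔ (β ≤ size h)
size-sem β s h = mk⇔ (at-least β h) (at-most β h)
  where
  at-least : ∀ β h → s , h ⊨ size≥ β → β ≤ size h
  at-least zero          h _ = z≤n
  at-least (suc zero)    h non-empty = n≢0⇒n>0 (non-empty ∘ size-zero-emp h)
  at-least (suc (suc β)) h (h₁ , h₂ , u , non-empty , rest) =
    subst (suc (suc β) ≤_) (sym (size-union h₁ h₂ h u))
          (+-mono-≤ (at-least 1 h₁ non-empty) (at-least (suc β) h₂ rest))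
  at-most : ∀ β h → β ≤ size h → s , h ⊨ size≥ β
  at-most zero          h _ = ⊤-true s h
  at-most (suc zero)    h pos is-emp with allocated-cell h pos
  ... | l , v , hl = contradiction (trans (sym hl) (is-emp l)) λ ()
  at-most (suc (suc β)) h big =
    let l , v , hl = allocated-cell h (≤-trans (s≤s z≤n) big)
    in single l v , update h l nothing , union-split h hl , single-non-empty l v ,
       at-most (suc β) _ (≤-pred (subst (suc (suc β) ≤_) (size-erase h hl) big))
    where
    single-non-empty : ∀ l v → s , single l v ⊨ (¬' emp)
    single-non-empty l v is-emp = contradiction (trans (sym (update-here empty l (just v))) (is-emp l)) λ ()

≡ᵇ-true : ∀ {m n} → (m ≡ᵇ n) ≡ true → m ≡ n
≡ᵇ-true {m} {n} e = ≡ᵇ⇒≡ m n (subst T (sym e) tt)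

≡ᵇ-false : ∀ {m n} → (m ≡ᵇ n) ≡ false → m ≢ n
≡ᵇ-false {m} {n} e m≡n = subst T e (≡⇒≡ᵇ m n m≡n)

rn-cases : ∀ y x z → (z ≡ y × rn y x z ≡ x) ⊎ (z ≢ y × rn y x z ≡ z)
rn-cases y x z with z ≡ᵇ y in e
... | true  = inj₁ (≡ᵇ-true e , refl)
... | false = inj₂ (≡ᵇ-false e , refl)

rn-hit : ∀ y x → rn y x y ≡ x
rn-hit y x with rn-cases y x y
... | inj₁ (_ , e)   = e
... | inj₂ (y≢y , _) = contradiction refl y≢y

rn-miss : ∀ y x {z} → z ≢ y → rn y x z ≡ z
rn-miss y x {z} z≢y with rn-cases y x z
... | inj₁ (z≡y , _) = contradiction z≡y z≢y
... | inj₂ (_ , e)   = e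

rn-self : ∀ y x → rn y x x ≡ x
rn-self y x with rn-cases y x x
... | inj₁ (_ , e) = e
... | inj₂ (_ , e) = e

rn-invisible : ∀ (s : Store) {y x} → s x ≡ s y → ∀ z → s (rn y x z) ≡ s z
rn-invisible s {y} {x} sx≡sy z with rn-cases y x z
... | inj₁ (refl , e) = trans (cong s e) sx≡sy
... | inj₂ (_ , e)    = cong s e

rename-sem : ∀ φ {y x} s → (∀ z → s (rn y x z) ≡ s z) →
             ∀ h → (s , h ⊨ (φ [ y ← x ])) ⇔ (s , h ⊨ φ)
rename-sem (a ≐ b)  s inv h rewrite inv a | inv b = mk⇔ id id
rename-sem (a ↪ b)  s inv h rewrite inv a | inv b = mk⇔ id id
rename-sem emp      s inv h = mk⇔ id id
rename-sem (¬' φ)   s inv h = mk⇔ (λ ¬a' a → ¬a' (from (rename-sem φ s inv h) a))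
                                  (λ ¬a a' → ¬a (to (rename-sem φ s inv h) a'))
rename-sem (φ ∧' ψ) s inv h =
  mk⇔ (λ (a , b) → to (rename-sem φ s inv h) a , to (rename-sem ψ s inv h) b)
      (λ (a , b) → from (rename-sem φ s inv h) a , from (rename-sem ψ s inv h) b)
rename-sem (φ *' ψ) s inv h =
  mk⇔ (λ (h₁ , h₂ , u , a , b) →
         h₁ , h₂ , u , to (rename-sem φ s inv h₁) a , to (rename-sem ψ s inv h₂) b)
      (λ (h₁ , h₂ , u , a , b) →
         h₁ , h₂ , u , from (rename-sem φ s inv h₁) a , from (rename-sem ψ s inv h₂) b)
rename-sem (φ -* ψ) s inv h =
  mk⇔ (λ w h' h'' u a → to (rename-sem ψ s inv h'') (w h' h'' u (from (rename-sem φ s inv h') a)))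
      (λ w h' h'' u a → from (rename-sem ψ s inv h'') (w h' h'' u (to (rename-sem φ s inv h') a)))

_≍_ : Set → Bool → Set
P ≍ b = P ⇔ (b ≡ true)

≍-does : ∀ {P} (d : Dec P) → P ≍ does d
≍-does (yes p) = mk⇔ (const refl) (const p)
≍-does (no ¬p) = mk⇔ (λ p → contradiction p ¬p) λ ()

≍-not : ∀ {P b} → P ≍ b → (¬ P) ≍ not b
≍-not {b = true}  P≍b = mk⇔ (λ ¬p → contradiction (from P≍b refl) ¬p) λ ()
≍-not {b = false} P≍b = mk⇔ (const refl) (λ _ p → contradiction (to P≍b p) λ ())

≍-∧ : ∀ {P Q a b} → P ≍ a → Q ≍ b → (P × Q) ≍ (a ∧ b)
≍-∧ {a = true}  P≍a Q≍b = mk⇔ (λ (_ , q) → to Q≍b q) (λ b → from P≍a refl , from Q≍b b)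
≍-∧ {a = false} P≍a Q≍b = mk⇔ (λ (p , _) → to P≍a p) λ ()

⟦_⟧ᴾ : PForm → (ℕ → Set) → Set
⟦ atom n   ⟧ᴾ I = I n
⟦ pneg p   ⟧ᴾ I = ¬ ⟦ p ⟧ᴾ I
⟦ pand p q ⟧ᴾ I = ⟦ p ⟧ᴾ I × ⟦ q ⟧ᴾ I

instantiate-sem : ∀ σ p s h → (s , h ⊨ instantiate σ p) ≡ ⟦ p ⟧ᴾ (λ n → s , h ⊨ σ n)
instantiate-sem σ (atom n)   s h = refl
instantiate-sem σ (pneg p)   s h = cong ¬_ (instantiate-sem σ p s h)
instantiate-sem σ (pand p q) s h = cong₂ _×_ (instantiate-sem σ p s h) (instantiate-sem σ q s h)

atoms : PForm → List ℕ
atoms (atom n)   = n ∷ []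
atoms (pneg p)   = atoms p
atoms (pand p q) = atoms p ++ atoms q

peval-≍ : ∀ I v p → All (λ n → I n ≍ v n) (atoms p) → ⟦ p ⟧ᴾ I ≍ peval v p
peval-≍ I v (atom n)   (agree ∷ []) = agree
peval-≍ I v (pneg p)   agree = ≍-not (peval-≍ I v p agree)
peval-≍ I v (pand p q) agree =
  ≍-∧ (peval-≍ I v p (++⁻ˡ (atoms p) agree)) (peval-≍ I v q (++⁻ʳ (atoms p) agree))

override : (ℕ → Bool) → ℕ → Bool → ℕ → Bool
override v n b m with m ≟ n
... | yes _ = b
... | no  _ = v m

override-≍ : ∀ {I : ℕ → Set} {v n b} → I n ≍ b →
             ∀ {m} → (m ≢ n → I m ≍ v m) → I m ≍ override v n b m
override-≍ {n = n} In≍b {m} elsewhere with m ≟ n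
... | yes refl = In≍b
... | no  m≢n  = elsewhere m≢n

agreeing-valuation : ∀ (I : ℕ → Set) ns → ¬ ¬ (Σ (ℕ → Bool) λ v → All (λ n → I n ≍ v n) ns)
agreeing-valuation I []       k = k (const true , [])
agreeing-valuation I (n ∷ ns) k = agreeing-valuation I ns λ (v , agree) →
  ¬¬-excluded-middle λ (d : Dec (I n)) →
    k (override v n (does d) ,
       override-≍ {I} {v} (≍-does d) (λ n≢n → contradiction refl n≢n) ∷
       All.map (λ agree-m → override-≍ {I} {v} (≍-does d) (const agree-m)) agree)

glivenko : ∀ {p} → Tautology p → ∀ I → ¬ ¬ ⟦ p ⟧ᴾ I
glivenko {p} tauto I =
  ¬¬-map (λ (v , agree) → from (peval-≍ I v p agree) (tauto v)) (agreeing-valuation I (atoms p))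

⋀-elim : ∀ (f : PVar → Form) X {s h} → s , h ⊨ ⋀ (mapL f X) → ∀ {x} → x ∈ X → s , h ⊨ f x
⋀-elim f (x ∷ X) (fx , _)   (here refl) = fx
⋀-elim f (x ∷ X) (_ , rest) (there x∈X) = ⋀-elim f X rest x∈X

remove-keeps : ∀ x {X y} → y ∈ X → y ≢ x → y ∈ remove x X
remove-keeps x {z ∷ X} {y} y∈ y≢x with z ≡ᵇ x in e | y∈
... | true  | here refl = contradiction (≡ᵇ-true e) y≢x
... | true  | there y∈X = remove-keeps x y∈X y≢x
... | false | here refl = here refl
... | false | there y∈X = there (remove-keeps x y∈X y≢x)

distinct-allocated : ∀ (s : Store) (X : List PVar) → Unique X → ∀ h →
                     (∀ {x} → x ∈ X → dom h (s x) ≡ true) →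
                     (∀ {x y} → x ∈ X → y ∈ X → x ≢ y → s x ≢ s y) → length X ≤ size h
distinct-allocated s []      _              h _     _        = z≤n
distinct-allocated s (x ∷ X) (x∉X ∷ unique) h alloc distinct
  with _ , hx ← cell-of-dom h (alloc (here refl)) =
  subst (suc (length X) ≤_) (sym (size-erase h hx))
        (s≤s (distinct-allocated s X unique (update h (s x) nothing) still-allocated
                (λ y∈X z∈X → distinct (there y∈X) (there z∈X))))
  where
  still-allocated : ∀ {y} → y ∈ X → dom (update h (s x) nothing) (s y) ≡ true
  still-allocated y∈X =
    trans (cong is-just (update-elsewhere h nothing
                           (distinct (there y∈X) (here refl) (≢-sym (All.lookup x∉X y∈X)))))
          (alloc (there y∈X))

¬¬-intro : ∀ {A : Set} → A → ¬ ¬ A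
¬¬-intro a ¬a = ¬a a

-- Every derivable formula is true in every memory state, up to double negation
-- (propositional reasoning is classical, the semantics is not).
sound : ∀ {φ} → ⊢C φ → ∀ s h → ¬ ¬ (s , h ⊨ φ)
sound (taut p σ tauto) s h = subst (λ A → ¬ ¬ A) (sym (instantiate-sem σ p s h)) (glivenko {p} tauto _)
sound (mp ⊢φ ⊢φ⇒ψ) s h ¬ψ = sound ⊢φ s h λ φ → sound ⊢φ⇒ψ s h λ φ⇒ψ → φ⇒ψ (φ , ¬ψ)
sound (ax-refl x) s h = ¬¬-intro refl
sound (ax-subst φ x y) s h = ¬¬-intro λ ((φ-true , x≡y) , ¬φ') →
  ¬φ' (from (rename-sem φ s (rn-invisible s x≡y) h) φ-true)
sound (ax-alloc x y) s h = ¬¬-intro λ (x↪y , ¬alloc) →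
  ¬alloc (from (alloc-sem x s h) (cong is-just x↪y))
sound (ax-fun x y z) s h = ¬¬-intro λ ((x↪y , x↪z) , y≢z) →
  y≢z (just-injective (trans (sym x↪y) x↪z))
sound (ax-size β) s h = ¬¬-intro λ (big , ¬smaller) →
  ¬smaller (from (size-sem β s h) (≤-trans (n≤1+n β) (to (size-sem (suc β) s h) big)))
sound (ax-count X unique) s h = ¬¬-intro λ (premise , ¬big) →
  ¬big (from (size-sem (length X) s h)
              (distinct-allocated s X unique h (allocated premise) (distinct premise)))
  where
  F : PVar → Form
  F x = alloc x ∧' ⋀ (mapL (λ y → x ≠' y) (remove x X))
  allocated : s , h ⊨ ⋀ (mapL F X) → ∀ {x} → x ∈ X → dom h (s x) ≡ true
  allocated premise x∈X = to (alloc-sem _ s h) (proj₁ (⋀-elim F X premise x∈X))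
  distinct : s , h ⊨ ⋀ (mapL F X) → ∀ {x y} → x ∈ X → y ∈ X → x ≢ y → s x ≢ s y
  distinct premise {x} x∈X y∈X x≢y =
    ⋀-elim (λ y → x ≠' y) (remove x X) (proj₂ (⋀-elim F X premise x∈X))
           (remove-keeps x y∈X (≢-sym x≢y))

core-dec : ∀ {φ} → Core φ → ∀ s h → Dec (s , h ⊨ φ)
core-dec (core-eq x y)  s h = s x ≟ s y
core-dec (core-alloc x) s h = map′ (from (alloc-sem x s h)) (to (alloc-sem x s h)) (dom h (s x) ≟ᵇ true)
core-dec (core-pt x y)  s h = ≡-dec _≟_ (fun h (s x)) (just (s y))
core-dec (core-size β)  s h = map′ (from (size-sem β s h)) (to (size-sem β s h)) (β ≤? size h)

bool-comb-dec : ∀ {φ} → BoolComb φ → ∀ s h → Dec (s , h ⊨ φ)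
bool-comb-dec (bc-core c)  s h = core-dec c s h
bool-comb-dec (bc-neg b)   s h = ¬? (bool-comb-dec b s h)
bool-comb-dec (bc-and b c) s h = bool-comb-dec b s h ×-dec bool-comb-dec c s h

-- Soundness: double negation is removed by decidability.
soundness : ∀ {φ} → BoolComb φ → ⊢C φ → Valid φ
soundness b ⊢φ s h = decidable-stable (bool-comb-dec b s h) (sound ⊢φ s h)

-- An enumeration of ℕ × ℕ along the diagonals (0,0), (0,1), (1,0), (0,2), ...
-- used to code core atoms as propositional atoms.
next : ℕ × ℕ → ℕ × ℕ
next (x , zero)  = zero , suc x
next (x , suc y) = suc x , y

unpair : ℕ → ℕ × ℕ
unpair zero    = 0 , 0
unpair (suc n) = next (unpair n)

-- tri d is the number of pairs on the diagonals before the d-th.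
tri : ℕ → ℕ
tri zero    = zero
tri (suc d) = suc d + tri d

pair : ℕ → ℕ → ℕ
pair x y = x + tri (x + y)

unpair-diagonal : ∀ d x y → x + y ≡ d → unpair (x + tri d) ≡ (x , y)
unpair-diagonal d       (suc x) y       x+y≡d =
  cong next (unpair-diagonal d x (suc y) (trans (+-suc x y) x+y≡d))
unpair-diagonal zero    zero    zero    _     = refl
unpair-diagonal (suc d) zero    (suc y) y≡d
  rewrite unpair-diagonal d d zero (+-identityʳ d) | suc-injective y≡d = refl

unpair-pair : ∀ x y → unpair (pair x y) ≡ (x , y)
unpair-pair x y = unpair-diagonal (x + y) x y refl

data CAtom : Set where
  eq pt : PVar → PVar → CAtom
  al    : PVar → CAtom
  sz    : ℕ → CAtom

⌜_⌝ₐ : CAtom → Form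
⌜ eq x y ⌝ₐ = x ≐ y
⌜ pt x y ⌝ₐ = x ↪ y
⌜ al x   ⌝ₐ = alloc x
⌜ sz β   ⌝ₐ = size≥ β

code : CAtom → ℕ
code (eq x y) = pair 0 (pair x y)
code (pt x y) = pair 1 (pair x y)
code (al x)   = pair 2 x
code (sz β)   = pair 3 β

decode-tagged : ℕ × ℕ → CAtom
decode-tagged (0 , n) = eq (proj₁ (unpair n)) (proj₂ (unpair n))
decode-tagged (1 , n) = pt (proj₁ (unpair n)) (proj₂ (unpair n))
decode-tagged (2 , n) = al n
decode-tagged (_ , n) = sz n

decode : ℕ → CAtom
decode n = decode-tagged (unpair n)

decode-code : ∀ a → decode (code a) ≡ a
decode-code (eq x y) rewrite unpair-pair 0 (pair x y) | unpair-pair x y = refl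
decode-code (pt x y) rewrite unpair-pair 1 (pair x y) | unpair-pair x y = refl
decode-code (al x)   rewrite unpair-pair 2 x = refl
decode-code (sz β)   rewrite unpair-pair 3 β = refl

data CProp : Set where
  ⟨_⟩ : CAtom → CProp
  ~_  : CProp → CProp
  _&_ : CProp → CProp → CProp

infixr 6 _&_
infix 7 ~_

_⇒_ : CProp → CProp → CProp
p ⇒ q = ~ (p & ~ q)
infixr 4 _⇒_

⌜_⌝ : CProp → Form
⌜ ⟨ a ⟩ ⌝ = ⌜ a ⌝ₐ
⌜ ~ p   ⌝ = ¬' ⌜ p ⌝
⌜ p & q ⌝ = ⌜ p ⌝ ∧' ⌜ q ⌝

ceval : (CAtom → Bool) → CProp → Bool
ceval ν ⟨ a ⟩   = ν a
ceval ν (~ p)   = not (ceval ν p)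
ceval ν (p & q) = ceval ν p ∧ ceval ν q

toPForm : CProp → PForm
toPForm ⟨ a ⟩   = atom (code a)
toPForm (~ p)   = pneg (toPForm p)
toPForm (p & q) = pand (toPForm p) (toPForm q)

instantiate-toPForm : ∀ q → instantiate (⌜_⌝ₐ ∘ decode) (toPForm q) ≡ ⌜ q ⌝
instantiate-toPForm ⟨ a ⟩   = cong ⌜_⌝ₐ (decode-code a)
instantiate-toPForm (~ p)   = cong ¬'_ (instantiate-toPForm p)
instantiate-toPForm (p & q) = cong₂ _∧'_ (instantiate-toPForm p) (instantiate-toPForm q)

peval-toPForm : ∀ v q → peval v (toPForm q) ≡ ceval (v ∘ code) q
peval-toPForm v ⟨ a ⟩   = refl
peval-toPForm v (~ p)   = cong not (peval-toPForm v p)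
peval-toPForm v (p & q) = cong₂ _∧_ (peval-toPForm v p) (peval-toPForm v q)

⊢-tautology : ∀ q → (∀ ν → ceval ν q ≡ true) → ⊢C ⌜ q ⌝
⊢-tautology q tauto = subst ⊢C_ (instantiate-toPForm q)
  (taut (toPForm q) (⌜_⌝ₐ ∘ decode) λ v → trans (peval-toPForm v q) (tauto (v ∘ code)))

⇒-true : ∀ {a b} → not (a ∧ not b) ≡ true → a ≡ true → b ≡ true
⇒-true {true} {true} _ _ = refl

⇒-intro : ∀ {a b} → (a ≡ true → b ≡ true) → not (a ∧ not b) ≡ true
⇒-intro {true}  a⇒b rewrite a⇒b refl = refl
⇒-intro {false} _   = refl

∧-true : ∀ {a b} → a ∧ b ≡ true → a ≡ true × b ≡ true
∧-true {true} {true} _ = refl , refl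

bool-ext : ∀ {a b} → (a ≡ true → b ≡ true) → (b ≡ true → a ≡ true) → a ≡ b
bool-ext {true}          a⇒b _   = sym (a⇒b refl)
bool-ext {false} {true}  _   b⇒a = b⇒a refl
bool-ext {false} {false} _   _   = refl

∧-intro : ∀ {φ ψ} → ⊢C φ → ⊢C ψ → ⊢C (φ ∧' ψ)
∧-intro {φ} {ψ} ⊢φ ⊢ψ = mp ⊢ψ (mp ⊢φ (taut (pimp p₀ (pimp p₁ (pand p₀ p₁))) σ tauto))
  where
  p₀ p₁ : PForm
  p₀ = atom 0
  p₁ = atom 1
  pimp : PForm → PForm → PForm
  pimp p q = pneg (pand p (pneg q))
  σ : ℕ → Form
  σ zero    = φ
  σ (suc _) = ψ
  tauto : Tautology (pimp p₀ (pimp p₁ (pand p₀ p₁)))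
  tauto v = ⇒-intro {v 0} λ v₀ → ⇒-intro {v 1} λ v₁ → cong₂ _∧_ v₀ v₁

⊤ᶜ : CProp
⊤ᶜ = ~ ~ ⟨ eq x₀ x₀ ⟩

⊢⊤ : ⊢C ⊤'
⊢⊤ = mp (ax-refl x₀) (⊢-tautology (⟨ eq x₀ x₀ ⟩ ⇒ ⊤ᶜ) λ ν →
  ⇒-intro {ν (eq x₀ x₀)} λ x₀=x₀ → cong not (cong not x₀=x₀))

⋀[_]_ : ∀ {A : Set} → List A → (A → CProp) → CProp
⋀[ []     ] f = ⊤ᶜ
⋀[ x ∷ xs ] f = f x & ⋀[ xs ] f

⌜⋀⌝ : ∀ {A : Set} xs (f : A → CProp) (g : A → Form) → (∀ x → ⌜ f x ⌝ ≡ g x) →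
      ⌜ ⋀[ xs ] f ⌝ ≡ ⋀ (mapL g xs)
⌜⋀⌝ []       f g f≡g = refl
⌜⋀⌝ (x ∷ xs) f g f≡g = cong₂ _∧'_ (f≡g x) (⌜⋀⌝ xs f g f≡g)

⊢-⋀ : ∀ {A : Set} xs (f : A → CProp) → (∀ {x} → x ∈ xs → ⊢C ⌜ f x ⌝) → ⊢C ⌜ ⋀[ xs ] f ⌝
⊢-⋀ []       f ⊢f = ⊢⊤
⊢-⋀ (x ∷ xs) f ⊢f = ∧-intro (⊢f (here refl)) (⊢-⋀ xs f (⊢f ∘ there))

⋀-true : ∀ {A : Set} {ν} xs (f : A → CProp) → ceval ν (⋀[ xs ] f) ≡ true →
         ∀ {x} → x ∈ xs → ceval ν (f x) ≡ true
⋀-true (x ∷ xs) f all-true (here refl) = proj₁ (∧-true all-true)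
⋀-true (x ∷ xs) f all-true (there x∈xs) = ⋀-true xs f (proj₂ (∧-true all-true)) x∈xs

⋀-intro : ∀ {A : Set} {ν} xs (f : A → CProp) → ν (eq x₀ x₀) ≡ true →
          (∀ {x} → x ∈ xs → ceval ν (f x) ≡ true) → ceval ν (⋀[ xs ] f) ≡ true
⋀-intro []       f x₀=x₀ _      = cong not (cong not x₀=x₀)
⋀-intro (x ∷ xs) f x₀=x₀ f-true =
  cong₂ _∧_ (f-true (here refl)) (⋀-intro xs f x₀=x₀ (f-true ∘ there))

subsets : ℕ → List (List ℕ)
subsets zero    = [] ∷ []
subsets (suc n) = map (n ∷_) (subsets n) ++ subsets n

subsets-ok : ∀ n → All (λ X → Unique X × All (_< n) X) (subsets n)
subsets-ok zero    = ([] , []) ∷ []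
subsets-ok (suc n) = ++⁺ (map⁺ (All.map add-top (subsets-ok n))) (All.map widen (subsets-ok n))
  where
  add-top : ∀ {X} → Unique X × All (_< n) X → Unique (n ∷ X) × All (_< suc n) (n ∷ X)
  add-top (unique , below) =
    All.map (λ x<n n≡x → <-irrefl (sym n≡x) x<n) below ∷ unique ,
    ≤-refl ∷ All.map m<n⇒m<1+n below
  widen : ∀ {X} → Unique X × All (_< n) X → Unique X × All (_< suc n) X
  widen (unique , below) = unique , All.map m<n⇒m<1+n below

select : (ℕ → Bool) → ℕ → List ℕ
select t zero    = []
select t (suc n) = if t n then n ∷ select t n else select t n

select-subsets : ∀ t n → select t n ∈ subsets n
select-subsets t zero    = here refl
select-subsets t (suc n) with t n
... | true  = ∈-++⁺ˡ (∈-map⁺ (n ∷_) (select-subsets t n))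
... | false = ∈-++⁺ʳ (map (n ∷_) (subsets n)) (select-subsets t n)

select-∈ : ∀ t n {x} → x ∈ select t n → x < n × t x ≡ true
select-∈ t (suc n) x∈ with t n in tn | x∈
... | true  | here refl = ≤-refl , tn
... | true  | there x∈s = let x<n , tx = select-∈ t n x∈s in m<n⇒m<1+n x<n , tx
... | false | x∈s       = let x<n , tx = select-∈ t n x∈s in m<n⇒m<1+n x<n , tx

select-length : ∀ t n → length (select t n) ≡ count t n
select-length t zero    = refl
select-length t (suc n) with t n
... | true  = cong suc (select-length t n)
... | false = select-length t n

remove-⊆ : ∀ x {X y} → y ∈ remove x X → y ∈ X × y ≢ x
remove-⊆ x {z ∷ X} y∈ with z ≡ᵇ x in e | y∈
... | true  | y∈r       = let y∈X , y≢x = remove-⊆ x y∈r in there y∈X , y≢x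
... | false | here refl = here refl , ≡ᵇ-false e
... | false | there y∈r = let y∈X , y≢x = remove-⊆ x y∈r in there y∈X , y≢x

renameₐ : PVar → PVar → CAtom → CAtom
renameₐ b a (eq u w) = eq (rn b a u) (rn b a w)
renameₐ b a (pt u w) = pt (rn b a u) (rn b a w)
renameₐ b a (al u)   = al (rn b a u)
renameₐ b a (sz β)   = sz β

-- The two substitution instances for c and a = b: the truth value of c is
-- that of c with b renamed to a.
substitution : CAtom → PVar → PVar → CProp
substitution c a b = (⟨ c ⟩ & ⟨ eq a b ⟩ ⇒ ⟨ renameₐ b a c ⟩) &
                     (~ ⟨ c ⟩ & ⟨ eq a b ⟩ ⇒ ~ ⟨ renameₐ b a c ⟩)

-- Derivable whenever renaming commutes with the formula of c (it fails only
-- for alloc when the variable 0 of ⊥' is renamed).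
⊢-substitution : ∀ c a b → ⌜ c ⌝ₐ [ b ← a ] ≡ ⌜ renameₐ b a c ⌝ₐ → ⊢C ⌜ substitution c a b ⌝
⊢-substitution c a b renamed =
  ∧-intro (subst (λ ψ → ⊢C ((⌜ c ⌝ₐ ∧' (a ≐ b)) ⇒' ψ)) renamed (ax-subst ⌜ c ⌝ₐ a b))
          (subst (λ ψ → ⊢C ((¬' ⌜ c ⌝ₐ ∧' (a ≐ b)) ⇒' ¬' ψ)) renamed (ax-subst (¬' ⌜ c ⌝ₐ) a b))

substitution-true : ∀ {ν} c a b → ceval ν (substitution c a b) ≡ true → ν (eq a b) ≡ true →
                    ν c ≡ ν (renameₐ b a c)
substitution-true {ν} c a b instance-true a=b
  with ν c | ν (renameₐ b a c) | ν (eq a b) | instance-true | a=b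
... | true  | true  | _ | _  | _ = refl
... | false | false | _ | _  | _ = refl
... | true  | false | true | () | _
... | false | true  | true | () | _

DistinctAllocated : ℕ → (CAtom → Bool) → (ℕ → Bool) → Set
DistinctAllocated B ν t =
  (∀ {x} → x < B → t x ≡ true → ν (al x) ≡ true) ×
  (∀ {x y} → x < B → y < B → t x ≡ true → t y ≡ true → x ≢ y → ν (eq x y) ≡ false)

-- The consequences of the axioms of C for a valuation ν of the core atoms with
-- variables below B and sizes up to N: these are all the model construction uses.
record Respects (B N : ℕ) (ν : CAtom → Bool) : Set where
  field
    eq-refl    : ∀ {u} → u < B → ν (eq u u) ≡ true
    size-down  : ∀ {k} → k < N → ν (sz (suc k)) ≡ true → ν (sz k) ≡ true
    pt-alloc   : ∀ {x y} → x < B → y < B → ν (pt x y) ≡ true → ν (al x) ≡ true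
    pt-fun     : ∀ {x y z} → x < B → y < B → z < B →
                 ν (pt x y) ≡ true → ν (pt x z) ≡ true → ν (eq y z) ≡ true
    rename-eq  : ∀ {a b u w} → a < B → b < B → u < B → w < B →
                 ν (eq a b) ≡ true → ν (eq u w) ≡ ν (eq (rn b a u) (rn b a w))
    rename-pt  : ∀ {a b u w} → a < B → b < B → u < B → w < B →
                 ν (eq a b) ≡ true → ν (pt u w) ≡ ν (pt (rn b a u) (rn b a w))
    -- alloc contains the variable x₀ = 0 (in ⊥'), so only non-zero variables are renamed.
    rename-al  : ∀ {a b u} → a < B → b < B → u < B →
                 ν (eq a (suc b)) ≡ true → ν (al u) ≡ ν (al (rn (suc b) a u))
    count-size : ∀ t → DistinctAllocated B ν t → ν (sz (count t B)) ≡ true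

module Axioms (B N : ℕ) where

  count-premise : List PVar → CProp
  count-premise X = ⋀[ X ] λ x → ⟨ al x ⟩ & ⋀[ remove x X ] λ y → ~ ⟨ eq x y ⟩

  G-refl G-size G-alloc G-fun G-subst G-count G : CProp
  G-refl  = ⋀[ downFrom B ] λ u → ⟨ eq u u ⟩
  G-size  = ⋀[ downFrom N ] λ k → ⟨ sz (suc k) ⟩ ⇒ ⟨ sz k ⟩
  G-alloc = ⋀[ downFrom B ] λ x → ⋀[ downFrom B ] λ y → ⟨ pt x y ⟩ ⇒ ⟨ al x ⟩
  G-fun   = ⋀[ downFrom B ] λ x → ⋀[ downFrom B ] λ y → ⋀[ downFrom B ] λ z →
              ⟨ pt x y ⟩ & ⟨ pt x z ⟩ ⇒ ⟨ eq y z ⟩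
  G-subst = ⋀[ downFrom B ] λ a → ⋀[ downFrom B ] λ b → ⋀[ downFrom B ] λ u → ⋀[ downFrom B ] λ w →
              substitution (eq u w) a b & substitution (pt u w) a b & substitution (al u) a (suc b)
  G-count = ⋀[ subsets B ] λ X → count-premise X ⇒ ⟨ sz (length X) ⟩
  G = G-refl & G-size & G-alloc & G-fun & G-subst & G-count

  ⊢G : ⊢C ⌜ G ⌝
  ⊢G = ∧-intro (⊢-⋀ (downFrom B) _ λ _ → ax-refl _)
      (∧-intro (⊢-⋀ (downFrom N) _ λ _ → ax-size _)
      (∧-intro (⊢-⋀ (downFrom B) _ λ _ → ⊢-⋀ (downFrom B) _ λ _ → ax-alloc _ _)
      (∧-intro (⊢-⋀ (downFrom B) _ λ _ → ⊢-⋀ (downFrom B) _ λ _ → ⊢-⋀ (downFrom B) _ λ _ →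
                  ax-fun _ _ _)
      (∧-intro (⊢-⋀ (downFrom B) _ λ {a} _ → ⊢-⋀ (downFrom B) _ λ {b} _ →
                ⊢-⋀ (downFrom B) _ λ {u} _ → ⊢-⋀ (downFrom B) _ λ {w} _ →
                  ∧-intro (⊢-substitution (eq u w) a b refl)
                 (∧-intro (⊢-substitution (pt u w) a b refl)
                          (⊢-substitution (al u) a (suc b) refl)))
               (⊢-⋀ (subsets B) _ λ {X} X∈ →
                  ⊢-count X (proj₁ (All.lookup (subsets-ok B) X∈)))))))
    where
    ⊢-count : ∀ X → Unique X → ⊢C ⌜ count-premise X ⇒ ⟨ sz (length X) ⟩ ⌝
    ⊢-count X unique = subst (λ φ → ⊢C (φ ⇒' size≥ (length X)))
      (sym (⌜⋀⌝ X _ _ λ x → cong (alloc x ∧'_) (⌜⋀⌝ (remove x X) _ _ λ _ → refl)))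
      (ax-count X unique)

  below-true : ∀ {ν} n (f : ℕ → CProp) → ceval ν (⋀[ downFrom n ] f) ≡ true →
               ∀ {x} → x < n → ceval ν (f x) ≡ true
  below-true n f all-true x<n = ⋀-true (downFrom n) f all-true (∈-downFrom⁺ x<n)

  substitution-instances : ∀ {ν a b u w} → ceval ν G-subst ≡ true →
                           a < B → b < B → u < B → w < B →
                           ceval ν (substitution (eq u w) a b) ≡ true ×
                           ceval ν (substitution (pt u w) a b) ≡ true ×
                           ceval ν (substitution (al u) a (suc b)) ≡ true
  substitution-instances subst-ok a<B b<B u<B w<B =
    let eq-ok , rest = ∧-true (below-true B _ (below-true B _ (below-true B _
                                 (below-true B _ subst-ok a<B) b<B) u<B) w<B)
    in eq-ok , ∧-true rest

  count-premise-true : ∀ {ν} t → ν (eq x₀ x₀) ≡ true → DistinctAllocated B ν t →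
                       ceval ν (count-premise (select t B)) ≡ true
  count-premise-true {ν} t x₀-refl (allocated , distinct) =
    ⋀-intro X _ x₀-refl λ {x} x∈X →
      let x<B , tx = select-∈ t B x∈X in
      cong₂ _∧_ (allocated x<B tx) (⋀-intro (remove x X) _ x₀-refl λ y∈ →
        let y∈X , y≢x = remove-⊆ x y∈
            y<B , ty  = select-∈ t B y∈X
        in cong not (distinct x<B y<B tx ty (≢-sym y≢x)))
    where X = select t B

  -- A valuation satisfying G respects the axioms (0 < B puts x₀ in scope).
  respects : 0 < B → ∀ ν → ceval ν G ≡ true → Respects B N ν
  respects 0<B ν G-true =
    let refl-ok  , G₁       = ∧-true G-true
        size-ok  , G₂       = ∧-true G₁
        alloc-ok , G₃       = ∧-true G₂
        fun-ok   , G₄       = ∧-true G₃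
        subst-ok , count-ok = ∧-true G₄
    in record
    { eq-refl    = below-true B _ refl-ok
    ; size-down  = λ k<N → ⇒-true (below-true N _ size-ok k<N)
    ; pt-alloc   = λ x<B y<B → ⇒-true (below-true B _ (below-true B _ alloc-ok x<B) y<B)
    ; pt-fun     = λ x<B y<B z<B xy xz →
                     ⇒-true (below-true B _ (below-true B _ (below-true B _ fun-ok x<B) y<B) z<B)
                            (cong₂ _∧_ xy xz)
    ; rename-eq  = λ {a} {b} {u} {w} a<B b<B u<B w<B →
                     substitution-true {ν} (eq u w) a b
                       (proj₁ (substitution-instances subst-ok a<B b<B u<B w<B))
    ; rename-pt  = λ {a} {b} {u} {w} a<B b<B u<B w<B →
                     substitution-true {ν} (pt u w) a b
                       (proj₁ (proj₂ (substitution-instances subst-ok a<B b<B u<B w<B)))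
    ; rename-al  = λ {a} {b} {u} a<B b<B u<B →
                     substitution-true {ν} (al u) a (suc b)
                       (proj₂ (proj₂ (substitution-instances {w = 0} subst-ok a<B b<B u<B 0<B)))
    ; count-size = λ t t-ok →
                     subst (λ n → ν (sz n) ≡ true) (select-length t B)
                       (⇒-true (⋀-true (subsets B) _ count-ok (select-subsets t B))
                               (count-premise-true t (below-true B _ refl-ok 0<B) t-ok))
    }

search : (ℕ → Bool) → ℕ → Maybe ℕ
search p zero    = nothing
search p (suc n) = if p n then just n else search p n

search-just : ∀ p n {l} → search p n ≡ just l → l < n × p l ≡ true
search-just p (suc n) found with p n in pn | found
... | true  | refl = ≤-refl , pn
... | false | rest = let l<n , pl = search-just p n rest in m<n⇒m<1+n l<n , pl

search-nothing : ∀ p n → search p n ≡ nothing → ∀ {l} → l < n → p l ≡ false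
search-nothing p (suc n) none {l} l<1+n with p n in pn | none | m<1+n⇒m<n∨m≡n l<1+n
... | false | rest | inj₁ l<n  = search-nothing p n rest l<n
... | false | _    | inj₂ refl = pn

search-ext : ∀ {p q} n → (∀ {l} → l < n → p l ≡ q l) → search p n ≡ search q n
search-ext zero    _   = refl
search-ext (suc n) p≗q rewrite p≗q {n} ≤-refl =
  cong (if _ then just n else_) (search-ext n (p≗q ∘ m<n⇒m<1+n))

is-just-if : ∀ b (v : Loc) → is-just (if b then just v else nothing) ≡ b
is-just-if true  v = refl
is-just-if false v = refl

if-just : ∀ b {u v : Loc} → (if b then just u else nothing) ≡ just v → b ≡ true × u ≡ v
if-just true refl = refl , refl

InScope : ℕ → ℕ → CAtom → Set
InScope B N (eq x y) = x < B × y < B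
InScope B N (pt x y) = x < B × y < B
InScope B N (al x)   = x < B
InScope B N (sz β)   = β ≤ N

Scoped : ℕ → ℕ → CProp → Set
Scoped B N ⟨ a ⟩   = InScope B N a
Scoped B N (~ p)   = Scoped B N p
Scoped B N (p & q) = Scoped B N p × Scoped B N q

-- Variables are stored as
-- canonical representatives of their ν-equality class; a represented variable is
-- allocated when ν says so and points to the representative of some ν-target;
-- dummy cells beyond B bring the heap to the largest size ν asserts.
module Model {B N : ℕ} (B≤N : B ≤ N) (ν : CAtom → Bool) (R : Respects B N ν) where
  open Respects R

  _~_ : PVar → PVar → Set
  x ~ y = ν (eq x y) ≡ true

  ~-sym : ∀ {a b} → a < B → b < B → a ~ b → b ~ a
  ~-sym {a} {b} a<B b<B a~b = begin
    ν (eq b a)                   ≡⟨ rename-eq a<B b<B b<B a<B a~b ⟩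
    ν (eq (rn b a b) (rn b a a)) ≡⟨ cong ν (cong₂ eq (rn-hit b a) (rn-self b a)) ⟩
    ν (eq a a)                   ≡⟨ eq-refl a<B ⟩
    true                         ∎
    where open ≡-Reasoning

  ~-trans : ∀ {a b c} → a < B → b < B → c < B → a ~ b → b ~ c → a ~ c
  ~-trans {a} {b} {c} a<B b<B c<B a~b b~c with c ≟ b
  ... | yes refl = a~b
  ... | no  c≢b  = begin
    ν (eq a c)                   ≡⟨ cong ν (cong₂ eq (rn-hit b a) (rn-miss b a c≢b)) ⟨
    ν (eq (rn b a b) (rn b a c)) ≡⟨ rename-eq a<B b<B b<B c<B a~b ⟨
    ν (eq b c)                   ≡⟨ b~c ⟩
    true                         ∎
    where open ≡-Reasoning

  -- alloc respects ~; the variable 0 can only be renamed away, not into.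
  al-cong : ∀ {a b} → a < B → b < B → a ~ b → ν (al a) ≡ ν (al b)
  al-cong {a} {suc b} a<B b<B a~b = sym (trans (rename-al a<B (<-trans (n<1+n b) b<B) b<B a~b)
                                               (cong (ν ∘ al) (rn-hit (suc b) a)))
  al-cong {zero}  {zero}  _   _   _   = refl
  al-cong {suc a} {zero}  a<B 0<B a~0 = trans (rename-al 0<B (<-trans (n<1+n a) a<B) a<B (~-sym a<B 0<B a~0))
                                              (cong (ν ∘ al) (rn-hit (suc a) 0))

  -- x ↪ y respects ~, one argument at a time: renaming u into u' turns both
  -- pt u w and pt u' w into the same atom.
  pt-cong-left : ∀ {u u' w} → u < B → u' < B → w < B → u ~ u' → ν (pt u w) ≡ ν (pt u' w)
  pt-cong-left {u} {u'} {w} u<B u'<B w<B u~u' =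
    trans (renamed u<B (rn-hit u u')) (sym (renamed u'<B (rn-self u u')))
    where
    renamed : ∀ {x} → x < B → rn u u' x ≡ u' → ν (pt x w) ≡ ν (pt u' (rn u u' w))
    renamed x<B x↦u' = trans (rename-pt u'<B u<B x<B w<B (~-sym u<B u'<B u~u'))
                             (cong (λ z → ν (pt z (rn u u' w))) x↦u')

  pt-cong-right : ∀ {u w w'} → u < B → w < B → w' < B → w ~ w' → ν (pt u w) ≡ ν (pt u w')
  pt-cong-right {u} {w} {w'} u<B w<B w'<B w~w' =
    trans (renamed w<B (rn-hit w w')) (sym (renamed w'<B (rn-self w w')))
    where
    renamed : ∀ {y} → y < B → rn w w' y ≡ w' → ν (pt u y) ≡ ν (pt (rn w w' u) w')
    renamed y<B y↦w' = trans (rename-pt w'<B w<B u<B y<B (~-sym w<B w'<B w~w'))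
                             (cong (λ z → ν (pt (rn w w' u) z)) y↦w')

  pt-cong : ∀ {u u' w w'} → u < B → u' < B → w < B → w' < B → u ~ u' → w ~ w' →
            ν (pt u w) ≡ ν (pt u' w')
  pt-cong u<B u'<B w<B w'<B u~u' w~w' =
    trans (pt-cong-left u<B u'<B w<B u~u') (pt-cong-right u'<B w<B w'<B w~w')

  -- rep x: a canonical element of the ~-class of x (x itself outside the scope).
  rep : PVar → PVar
  rep x = fromMaybe x (search (λ y → ν (eq y x)) B)

  class-found : ∀ {x} → x < B → ∃[ y ] search (λ y → ν (eq y x)) B ≡ just y
  class-found {x} x<B with search (λ y → ν (eq y x)) B in found
  ... | just y  = y , refl
  ... | nothing = contradiction (trans (sym (eq-refl x<B)) (search-nothing _ B found x<B)) λ ()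

  rep-spec : ∀ {x} → x < B → rep x < B × rep x ~ x
  rep-spec x<B = let y , found = class-found x<B in
    subst (λ r → r < B × r ~ _) (sym (cong (fromMaybe _) found)) (search-just _ B found)

  rep<B : ∀ {x} → x < B → rep x < B
  rep<B x<B = proj₁ (rep-spec x<B)

  rep~ : ∀ {x} → x < B → rep x ~ x
  rep~ x<B = proj₂ (rep-spec x<B)

  -- ~-equal variables have the same class, hence the same search result.
  rep-resp : ∀ {x x'} → x < B → x' < B → x ~ x' → rep x ≡ rep x'
  rep-resp {x} {x'} x<B x'<B x~x' = let y , found = class-found x'<B in
    trans (cong (fromMaybe x) (trans (search-ext B same-class) found)) (sym (cong (fromMaybe x') found))
    where
    same-class : ∀ {y} → y < B → ν (eq y x) ≡ ν (eq y x')
    same-class y<B = bool-ext (λ y~x → ~-trans y<B x<B x'<B y~x x~x')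
                              (λ y~x' → ~-trans y<B x'<B x<B y~x' (~-sym x<B x'<B x~x'))

  rep-reflect : ∀ {x x'} → x < B → x' < B → rep x ≡ rep x' → x ~ x'
  rep-reflect x<B x'<B same = ~-trans x<B (rep<B x<B) x'<B (~-sym (rep<B x<B) x<B (rep~ x<B))
                                (subst (_~ _) (sym same) (rep~ x'<B))

  rep-idem : ∀ {x} → x < B → rep (rep x) ≡ rep x
  rep-idem x<B = rep-resp (rep<B x<B) x<B (rep~ x<B)

  -- The value of cell l: the representative of some ν-target of l, or the
  -- location B, which is no representative, if there is none.
  tgt : Loc → Loc
  tgt l = maybe′ rep B (search (λ y → ν (pt l y)) B)

  tgt-sem : ∀ {l y} → l < B → y < B → (tgt l ≡ rep y) ⇔ (ν (pt l y) ≡ true)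
  tgt-sem {l} {y} l<B y<B = mk⇔ points-to target
    where
    points-to : tgt l ≡ rep y → ν (pt l y) ≡ true
    points-to t≡ with search (λ z → ν (pt l z)) B in found
    ... | nothing = contradiction (sym t≡) (<⇒≢ (rep<B y<B))
    ... | just z  = let z<B , lz = search-just _ B found in
                    trans (pt-cong-right l<B y<B z<B (rep-reflect y<B z<B (sym t≡))) lz
    target : ν (pt l y) ≡ true → tgt l ≡ rep y
    target ly with search (λ z → ν (pt l z)) B in found
    ... | nothing = contradiction (trans (sym ly) (search-nothing _ B found y<B)) λ ()
    ... | just z  = let z<B , lz = search-just _ B found in
                    rep-resp z<B y<B (pt-fun l<B z<B y<B lz ly)

  -- The allocated cells below B are the representatives x with ν (al x).
  owned : Loc → Bool
  owned l = (rep l ≡ᵇ l) ∧ ν (al l)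

  owned-rep : ∀ {x} → x < B → owned (rep x) ≡ ν (al x)
  owned-rep x<B =
    cong₂ _∧_ (to T-≡ (≡⇒≡ᵇ _ _ (rep-idem x<B))) (al-cong (rep<B x<B) x<B (rep~ x<B))

  -- Distinct owned locations are not ~-equal, so the counting axiom applies to them.
  owned-size : ν (sz (count owned B)) ≡ true
  owned-size = count-size owned ((λ _ ox → proj₂ (∧-true ox)) , distinct)
    where
    distinct : ∀ {x y} → x < B → y < B → owned x ≡ true → owned y ≡ true → x ≢ y →
               ν (eq x y) ≡ false
    distinct {x} {y} x<B y<B ox oy x≢y with ν (eq x y) in x~y
    ... | false = refl
    ... | true  = contradiction (begin
      x     ≡⟨ ≡ᵇ-true (proj₁ (∧-true ox)) ⟨
      rep x ≡⟨ rep-resp x<B y<B x~y ⟩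
      rep y ≡⟨ ≡ᵇ-true (proj₁ (∧-true oy)) ⟩
      y     ∎) x≢y
      where open ≡-Reasoning

  -- top n: the largest j ≤ n with ν (sz j); ν asserts exactly the sizes up to top N.
  top : ℕ → ℕ
  top zero    = zero
  top (suc n) = if ν (sz (suc n)) then suc n else top n

  top-≤ : ∀ n → top n ≤ n
  top-≤ zero    = z≤n
  top-≤ (suc n) with ν (sz (suc n))
  ... | true  = ≤-refl
  ... | false = m≤n⇒m≤1+n (top-≤ n)

  top-true : ∀ n → ν (sz (top n)) ≡ true
  top-true zero    =
    subst (λ k → ν (sz k) ≡ true) (count-false B) (count-size (const false) ((λ _ ()) , (λ _ _ ())))
  top-true (suc n) with ν (sz (suc n)) in sn
  ... | true  = sn
  ... | false = top-true n

  top-max : ∀ {j} n → j ≤ n → ν (sz j) ≡ true → j ≤ top n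
  top-max {zero}  n       _   _  = z≤n
  top-max {suc j} (suc n) j≤n sj with ν (sz (suc n)) in sn | m≤n⇒m<n∨m≡n j≤n
  ... | true  | _              = j≤n
  ... | false | inj₁ j<1+n     = top-max n (≤-pred j<1+n) sj
  ... | false | inj₂ refl      = contradiction (trans (sym sj) sn) λ ()

  size-closed : ∀ {j} d → j + d ≤ N → ν (sz (j + d)) ≡ true → ν (sz j) ≡ true
  size-closed {j} zero    _     s = subst (λ k → ν (sz k) ≡ true) (+-identityʳ j) s
  size-closed {j} (suc d) j+d<N s =
    size-closed d (<⇒≤ j+d<N') (size-down j+d<N' (subst (λ k → ν (sz k) ≡ true) (+-suc j d) s))
    where
    j+d<N' : j + d < N
    j+d<N' = subst (_≤ N) (+-suc j d) j+d<N

  top-sem : ∀ {j} → j ≤ N → (j ≤ top N) ⇔ (ν (sz j) ≡ true)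
  top-sem {j} j≤N = mk⇔ below (top-max N j≤N)
    where
    below : j ≤ top N → ν (sz j) ≡ true
    below j≤top = size-closed (top N ∸ j) (subst (_≤ N) (sym j+d≡top) (top-≤ N))
                              (subst (λ k → ν (sz k) ≡ true) (sym j+d≡top) (top-true N))
      where
      j+d≡top : j + (top N ∸ j) ≡ top N
      j+d≡top = m+[n∸m]≡n j≤top

  -- k owned cells, target size m, and pad dummy cells to reach it.
  k m pad : ℕ
  k   = count owned B
  m   = top N
  pad = m ∸ k

  k≤m : k ≤ m
  k≤m = top-max N (≤-trans (count-≤ owned B) B≤N) owned-size

  cell : Loc → Maybe Loc
  cell l with l <? B | l <? pad + B
  ... | yes _ | _     = if owned l then just (tgt l) else nothing
  ... | no  _ | yes _ = just 0
  ... | no  _ | no  _ = nothing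

  cell-low : ∀ {l} → l < B → cell l ≡ (if owned l then just (tgt l) else nothing)
  cell-low {l} l<B with l <? B
  ... | yes _   = refl
  ... | no  l≮B = contradiction l<B l≮B

  cell-pad : ∀ {l} → B ≤ l → l < pad + B → cell l ≡ just 0
  cell-pad {l} B≤l l<pad+B with l <? B | l <? pad + B
  ... | yes l<B | _       = contradiction B≤l (<⇒≱ l<B)
  ... | no  _   | yes _   = refl
  ... | no  _   | no  l≮ = contradiction l<pad+B l≮

  cell-high : ∀ l → pad + B ≤ l → cell l ≡ nothing
  cell-high l high with l <? B | l <? pad + B
  ... | yes l<B | _     = contradiction (≤-trans (m≤n+m B pad) high) (<⇒≱ l<B)
  ... | no  _   | yes l< = contradiction high (<⇒≱ l<)
  ... | no  _   | no  _  = refl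

  heap : Heap
  heap = record { fun = cell ; bound = pad + B ; finite = cell-high }

  heap-size : size heap ≡ m
  heap-size = begin
    count (dom heap) (pad + B) ≡⟨ count-pad pad B dummies ⟩
    pad + count (dom heap) B   ≡⟨ cong (pad +_) (count-ext B owned-below) ⟩
    pad + k                    ≡⟨ m∸n+n≡m k≤m ⟩
    m                          ∎
    where
    open ≡-Reasoning
    dummies : ∀ {i} → i < pad → dom heap (i + B) ≡ true
    dummies i<pad = cong is-just (cell-pad (m≤n+m B _) (+-monoˡ-< B i<pad))
    owned-below : ∀ {l} → l < B → dom heap l ≡ owned l
    owned-below l<B = trans (cong is-just (cell-low l<B)) (is-just-if _ _)

  cell-rep : ∀ {x} → x < B → cell (rep x) ≡ (if ν (al x) then just (tgt (rep x)) else nothing)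
  cell-rep {x} x<B = trans (cell-low (rep<B x<B))
                           (cong (λ b → if b then just (tgt (rep x)) else nothing) (owned-rep x<B))

  dom-rep : ∀ {x} → x < B → dom heap (rep x) ≡ ν (al x)
  dom-rep x<B = trans (cong is-just (cell-rep x<B)) (is-just-if _ _)

  points-to : ∀ {x y} → x < B → y < B → (cell (rep x) ≡ just (rep y)) ⇔ (ν (pt x y) ≡ true)
  points-to {x} {y} x<B y<B = mk⇔ to-ν from-ν
    where
    rep-x-pt : ν (pt (rep x) y) ≡ ν (pt x y)
    rep-x-pt = pt-cong-left (rep<B x<B) x<B y<B (rep~ x<B)
    to-ν : cell (rep x) ≡ just (rep y) → ν (pt x y) ≡ true
    to-ν c = trans (sym rep-x-pt)
      (to (tgt-sem (rep<B x<B) y<B) (proj₂ (if-just (ν (al x)) (trans (sym (cell-rep x<B)) c))))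
    from-ν : ν (pt x y) ≡ true → cell (rep x) ≡ just (rep y)
    from-ν xy rewrite cell-rep x<B | pt-alloc x<B y<B xy =
      cong just (from (tgt-sem (rep<B x<B) y<B) (trans rep-x-pt xy))

  atom-agrees : ∀ a → InScope B N a → (rep , heap ⊨ ⌜ a ⌝ₐ) ≍ ν a
  atom-agrees (eq x y) (x<B , y<B) = mk⇔ (rep-reflect x<B y<B) (rep-resp x<B y<B)
  atom-agrees (pt x y) (x<B , y<B) = points-to x<B y<B
  atom-agrees (al x)   x<B         =
    ⇔.trans (alloc-sem x rep heap) (mk⇔ (trans (sym (dom-rep x<B))) (trans (dom-rep x<B)))
  atom-agrees (sz β)   β≤N         =
    ⇔.trans (size-sem β rep heap)
            (⇔.trans (mk⇔ (subst (β ≤_) heap-size) (subst (β ≤_) (sym heap-size))) (top-sem β≤N))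

  agrees : ∀ q → Scoped B N q → (rep , heap ⊨ ⌜ q ⌝) ≍ ceval ν q
  agrees ⟨ a ⟩   a-in  = atom-agrees a a-in
  agrees (~ p)   p-in  = ≍-not (agrees p p-in)
  agrees (p & q) (p-in , q-in) = ≍-∧ (agrees p p-in) (agrees q q-in)

tr : ∀ {φ} → BoolComb φ → CProp
tr (bc-core (core-eq x y))  = ⟨ eq x y ⟩
tr (bc-core (core-alloc x)) = ⟨ al x ⟩
tr (bc-core (core-pt x y))  = ⟨ pt x y ⟩
tr (bc-core (core-size β))  = ⟨ sz β ⟩
tr (bc-neg b)               = ~ tr b
tr (bc-and b c)             = tr b & tr c

⌜tr⌝ : ∀ {φ} (b : BoolComb φ) → ⌜ tr b ⌝ ≡ φ
⌜tr⌝ (bc-core (core-eq x y))  = refl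
⌜tr⌝ (bc-core (core-alloc x)) = refl
⌜tr⌝ (bc-core (core-pt x y))  = refl
⌜tr⌝ (bc-core (core-size β))  = refl
⌜tr⌝ (bc-neg b)               = cong ¬'_ (⌜tr⌝ b)
⌜tr⌝ (bc-and b c)             = cong₂ _∧'_ (⌜tr⌝ b) (⌜tr⌝ c)

var-bound size-bound : CProp → ℕ
var-bound ⟨ eq x y ⟩ = x ⊔ y
var-bound ⟨ pt x y ⟩ = x ⊔ y
var-bound ⟨ al x ⟩   = x
var-bound ⟨ sz _ ⟩   = 0
var-bound (~ p)      = var-bound p
var-bound (p & q)    = var-bound p ⊔ var-bound q
size-bound ⟨ sz β ⟩  = β
size-bound ⟨ _ ⟩     = 0
size-bound (~ p)     = size-bound p
size-bound (p & q)   = size-bound p ⊔ size-bound q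

scoped : ∀ q {B N} → var-bound q < B → size-bound q ≤ N → Scoped B N q
scoped ⟨ eq x y ⟩ v<B _ = m⊔n<o⇒m<o x y v<B , m⊔n<o⇒n<o x y v<B
scoped ⟨ pt x y ⟩ v<B _ = m⊔n<o⇒m<o x y v<B , m⊔n<o⇒n<o x y v<B
scoped ⟨ al x ⟩   v<B _ = v<B
scoped ⟨ sz β ⟩   _ s≤N = s≤N
scoped (~ p)      v<B s≤N = scoped p v<B s≤N
scoped (p & q)    v<B s≤N =
  scoped p (m⊔n<o⇒m<o _ _ v<B) (m⊔n≤o⇒m≤o _ _ s≤N) ,
  scoped q (m⊔n<o⇒n<o _ _ v<B) (m⊔n≤o⇒n≤o _ _ s≤N)

completeness : ∀ {φ} → BoolComb φ → Valid φ → ⊢C φ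
completeness b valid = subst ⊢C_ (⌜tr⌝ b) (mp ⊢G (⊢-tautology (G ⇒ q) G-entails-q))
  where
  q : CProp
  q = tr b
  B N : ℕ
  B = suc (var-bound q)
  N = B ⊔ size-bound q
  open Axioms B N
  G-entails-q : ∀ ν → ceval ν (G ⇒ q) ≡ true
  G-entails-q ν = ⇒-intro {ceval ν G} λ G-true →
    let open Model (m≤m⊔n B (size-bound q)) ν (respects z<s ν G-true)
    in to (agrees q (scoped q ≤-refl (m≤n⊔m B (size-bound q))))
          (subst (rep , heap ⊨_) (sym (⌜tr⌝ b)) (valid rep heap))

theorem3p2 : ∀ (φ : Form) → BoolComb φ → (Valid φ ⇔ (⊢C φ))
theorem3p2 φ b = mk⇔ (completeness b) (soundness b)
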